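{- Let $p\geq 1$ be an integer and $N=2p$. For $n=1,\dots,N$ put $w_n(x)=x^{n-1}$. Let $\sigma\in S_N$ be a permutation such that the polynomial \[ \bigl(w_{\sigma(1)}\,\partial_x^p\circ w_{\sigma(2)}\,\partial_x^p\circ\cdots\circ w_{\sigma(N-1)}\,\partial_x^p\bigr)\bigl(w_{\sigma(N)}\bigr) \] is not identically zero. Then $\sigma(1)=1$.
   Context: Permutations are written in one-line notation $\sigma=(\sigma(1),\dots,\sigma(N))$. In the displayed expression, $w\,\partial_x^p$ denotes the operator $g\mapsto w\cdot \partial_x^p g$, and the operators are composed and applied to the function $w_{\sigma(N)}$ (multiplication by $w_{\sigma(k)}$ followed by differentiation from right to left). -}

module Defs where

open import Data.Nat using (ℕ; zero; suc; _*_)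
open import Data.List using (List; []; _∷_; _++_; replicate; map)
open import Data.Fin using (Fin; toℕ)
open import Data.List using () renaming (allFin to allFinL)
open import Data.Fin.Permutation using (Permutation′; _⟨$⟩ʳ_)
open import Relation.Binary.PropositionalEquality using (_≡_)
open import Relation.Nullary using (¬_)

-- Polynomials in x with natural-number coefficients, as dense coefficient
-- lists: the list (a₀ ∷ a₁ ∷ … ∷ aₘ ∷ []) stands for a₀ + a₁ x + … + aₘ xᵐ.
-- (All polynomials occurring in the statement have coefficients in ℕ.)
Poly : Set
Poly = List ℕ

coeff : Poly → ℕ → ℕ
coeff []       _       = 0
coeff (a ∷ as) zero    = a
coeff (a ∷ as) (suc i) = coeff as i

IsZeroPoly : Poly → Set
IsZeroPoly f = ∀ i → coeff f i ≡ 0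

monomial : ℕ → Poly
monomial e = replicate e 0 ++ (1 ∷ [])

mulXPow : ℕ → Poly → Poly
mulXPow e f = replicate e 0 ++ f

derivFrom : ℕ → Poly → Poly
derivFrom k []       = []
derivFrom k (b ∷ bs) = (k * b) ∷ derivFrom (suc k) bs

deriv : Poly → Poly
deriv []       = []
deriv (a ∷ as) = derivFrom 1 as

derivPow : ℕ → Poly → Poly
derivPow zero    f = f
derivPow (suc p) f = deriv (derivPow p f)

-- Given exponents e₁,…,e_N (list), computes
--   (x^{e₁} ∂ᵖ ∘ x^{e₂} ∂ᵖ ∘ ⋯ ∘ x^{e_{N-1}} ∂ᵖ)(x^{e_N}).
-- (The empty list is never used; it is sent to the zero polynomial.)
opChain : ℕ → List ℕ → Poly
opChain p []           = []
opChain p (e ∷ [])     = monomial e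
opChain p (e ∷ e′ ∷ es) = mulXPow e (derivPow p (opChain p (e′ ∷ es)))

-- w_n(x) = x^{n-1}; with 0-based indices i : Fin N, w_i = x^{toℕ i}.
-- The list of exponents of w_{σ(1)}, …, w_{σ(N)}.
exponents : ∀ {N} → Permutation′ N → List ℕ
exponents {N} σ = map (λ i → toℕ (σ ⟨$⟩ʳ i)) (allFinL N)

chainPoly : (p : ℕ) → ∀ {N} → Permutation′ N → Poly
chainPoly p σ = opChain p (exponents σ)

module Submission where

-- Each factor x^e ∂ᵖ shifts degrees by e − p, so the chain is homogeneous of degree
-- Σ e − p (N − 1).  The exponents are a permutation of 0, …, N − 1, whose sum is
-- N (N − 1) / 2 = p (N − 1): the chain is a constant.  Being multiplied last by x^{σ(1)−1},
-- it has no monomial of degree below σ(1) − 1, so it vanishes unless σ(1) = 1.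

open import Defs
open import Data.Nat using (ℕ; zero; suc; _+_; _≤_; _*_)
open import Data.Nat.Properties
open import Data.Nat.ListAction using (sum)
open import Data.Nat.Tactic.RingSolver using (solve-∀)
open import Data.Fin using (Fin; toℕ; zero; suc)
open import Data.Fin.Permutation using (Permutation′; _⟨$⟩ʳ_)
open import Data.List using (List; []; _∷_; length; map; tabulate)
open import Data.List.Properties using (length-map; length-tabulate; map-tabulate)
open import Data.Product using (∃; _×_; _,_)
open import Data.Vec.Functional using (Vector)
open import Algebra.Properties.CommutativeMonoid.Sum +-0-commutativeMonoid
  using (sum-permute) renaming (sum to ∑)
open import Algebra.Properties.CommutativeSemigroup +-commutativeSemigroup using (x∙yz≈y∙xz)
open import Function using (_∘_; id)
open import Relation.Binary.PropositionalEquality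
open import Relation.Nullary using (¬_; contradiction)
open import Relation.Nullary.Decidable using (decidable-stable)
open ≡-Reasoning

IsZeroPoly-unless : ∀ {P : Set} f → (∀ i → coeff f i ≢ 0 → P) → ¬ P → IsZeroPoly f
IsZeroPoly-unless f support ¬P i = decidable-stable (coeff f i ≟ 0) (¬P ∘ support i)

mulXPow-support : ∀ e f i → coeff (mulXPow e f) i ≢ 0 → ∃ λ j → i ≡ e + j × coeff f j ≢ 0
mulXPow-support zero    f i       nz = i , refl , nz
mulXPow-support (suc e) f zero    nz = contradiction refl nz
mulXPow-support (suc e) f (suc i) nz with mulXPow-support e f i nz
... | j , refl , nz′ = j , refl , nz′

monomial-support : ∀ e i → coeff (monomial e) i ≢ 0 → i ≡ e
monomial-support e i nz with mulXPow-support e (1 ∷ []) i nz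
... | zero  , i≡e+0 , _  = trans i≡e+0 (+-identityʳ e)
... | suc _ , _     , nz′ = contradiction refl nz′

coeff-derivFrom : ∀ k bs i → coeff (derivFrom k bs) i ≡ (k + i) * coeff bs i
coeff-derivFrom k []       i       = sym (*-zeroʳ (k + i))
coeff-derivFrom k (b ∷ bs) zero    = cong (_* b) (sym (+-identityʳ k))
coeff-derivFrom k (b ∷ bs) (suc i) =
  trans (coeff-derivFrom (suc k) bs i) (cong (_* coeff bs i) (sym (+-suc k i)))

coeff-deriv : ∀ f i → coeff (deriv f) i ≡ suc i * coeff f (suc i)
coeff-deriv []       i = sym (*-zeroʳ (suc i))
coeff-deriv (a ∷ as) i = coeff-derivFrom 1 as i

deriv-support : ∀ f i → coeff (deriv f) i ≢ 0 → coeff f (suc i) ≢ 0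
deriv-support f i nz c≡0 = nz (begin
  coeff (deriv f) i        ≡⟨ coeff-deriv f i ⟩
  suc i * coeff f (suc i)  ≡⟨ cong (suc i *_) c≡0 ⟩
  suc i * 0                ≡⟨ *-zeroʳ (suc i) ⟩
  0                        ∎)

derivPow-support : ∀ p f i → coeff (derivPow p f) i ≢ 0 → coeff f (p + i) ≢ 0
derivPow-support zero    f i nz = nz
derivPow-support (suc p) f i nz =
  subst (λ k → coeff f k ≢ 0) (+-suc p i)
        (derivPow-support p f (suc i) (deriv-support (derivPow p f) i nz))

opChain-head≤support : ∀ p e es i → coeff (opChain p (e ∷ es)) i ≢ 0 → e ≤ i
opChain-head≤support p e []        i nz = ≤-reflexive (sym (monomial-support e i nz))
opChain-head≤support p e (e′ ∷ es) i nz
  with mulXPow-support e (derivPow p (opChain p (e′ ∷ es))) i nz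
... | j , refl , _ = m≤m+n e j

opChain-homogeneous : ∀ p e es i → coeff (opChain p (e ∷ es)) i ≢ 0 →
                      i + p * length es ≡ sum (e ∷ es)
opChain-homogeneous p e []        i nz with monomial-support e i nz
... | refl = cong (i +_) (*-zeroʳ p)
opChain-homogeneous p e (e′ ∷ es) i nz
  with mulXPow-support e (derivPow p (opChain p (e′ ∷ es))) i nz
... | j , refl , nz′ = begin
  e + j + p * suc (length es)    ≡⟨ rearrange e j p (length es) ⟩
  e + (p + j + p * length es)    ≡⟨ cong (e +_) (opChain-homogeneous p e′ es (p + j) nz″) ⟩
  e + sum (e′ ∷ es)              ∎
  where
  nz″ : coeff (opChain p (e′ ∷ es)) (p + j) ≢ 0
  nz″ = derivPow-support p (opChain p (e′ ∷ es)) j nz′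
  rearrange : ∀ e j p l → e + j + p * suc l ≡ e + (p + j + p * l)
  rearrange = solve-∀

sum-tabulate : ∀ {n} (f : Vector ℕ n) → sum (tabulate f) ≡ ∑ f
sum-tabulate {zero}  f = refl
sum-tabulate {suc n} f = cong (f zero +_) (sum-tabulate (f ∘ suc))

∑-suc : ∀ {n} (f : Vector ℕ n) → ∑ (suc ∘ f) ≡ n + ∑ f
∑-suc {zero}  f = refl
∑-suc {suc n} f = cong suc (begin
  f zero + ∑ (suc ∘ f ∘ suc)  ≡⟨ cong (f zero +_) (∑-suc (f ∘ suc)) ⟩
  f zero + (n + ∑ (f ∘ suc))  ≡⟨ x∙yz≈y∙xz (f zero) n _ ⟩
  n + (f zero + ∑ (f ∘ suc))  ∎)

2*∑toℕ≡[1+n]*n : ∀ n → 2 * ∑ (toℕ {suc n}) ≡ suc n * n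
2*∑toℕ≡[1+n]*n zero    = refl
2*∑toℕ≡[1+n]*n (suc n) = begin
  2 * ∑ (suc ∘ toℕ {suc n})        ≡⟨ cong (2 *_) (∑-suc (toℕ {suc n})) ⟩
  2 * (suc n + ∑ (toℕ {suc n}))    ≡⟨ *-distribˡ-+ 2 (suc n) (∑ (toℕ {suc n})) ⟩
  2 * suc n + 2 * ∑ (toℕ {suc n})  ≡⟨ cong (2 * suc n +_) (2*∑toℕ≡[1+n]*n n) ⟩
  2 * suc n + suc n * n            ≡⟨ factor n ⟩
  suc (suc n) * suc n              ∎
  where
  factor : ∀ n → 2 * suc n + suc n * n ≡ suc (suc n) * suc n
  factor = solve-∀

sum-exponents : ∀ {N} (σ : Permutation′ N) → sum (exponents σ) ≡ ∑ (toℕ {N})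
sum-exponents {N} σ = begin
  sum (map f (tabulate id))  ≡⟨ cong sum (map-tabulate id f) ⟩
  sum (tabulate f)           ≡⟨ sum-tabulate f ⟩
  ∑ f                        ≡⟨ sum-permute toℕ σ ⟨
  ∑ (toℕ {N})                ∎
  where
  f : Vector ℕ N
  f i = toℕ (σ ⟨$⟩ʳ i)

-- exponents σ reduces to toℕ (σ ⟨$⟩ʳ zero) ∷ exponentsTail σ.
exponentsTail : ∀ {L} → Permutation′ (suc L) → List ℕ
exponentsTail {L} σ = map (λ j → toℕ (σ ⟨$⟩ʳ j)) (tabulate {n = L} suc)

length-exponentsTail : ∀ {L} (σ : Permutation′ (suc L)) → length (exponentsTail σ) ≡ L
length-exponentsTail {L} σ = trans (length-map _ (tabulate {n = L} suc)) (length-tabulate suc)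

chainPoly-support≡0 : ∀ p {L} (σ : Permutation′ (suc L)) → 2 * p ≡ suc L →
                      ∀ i → coeff (chainPoly p σ) i ≢ 0 → i ≡ 0
chainPoly-support≡0 p {L} σ 2p≡N i nz = +-cancelʳ-≡ (p * L) i 0 (*-cancelˡ-≡ _ _ 2 (begin
  2 * (i + p * L)                         ≡⟨ cong (λ l → 2 * (i + p * l)) (length-exponentsTail σ) ⟨
  2 * (i + p * length (exponentsTail σ))  ≡⟨ cong (2 *_) degree ⟩
  2 * sum (exponents σ)                   ≡⟨ cong (2 *_) (sum-exponents σ) ⟩
  2 * ∑ (toℕ {suc L})                     ≡⟨ 2*∑toℕ≡[1+n]*n L ⟩
  suc L * L                               ≡⟨ cong (_* L) 2p≡N ⟨
  2 * p * L                               ≡⟨ *-assoc 2 p L ⟩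
  2 * (p * L)                             ∎))
  where
  degree : i + p * length (exponentsTail σ) ≡ sum (exponents σ)
  degree = opChain-homogeneous p _ (exponentsTail σ) i nz

chainPoly-support⇒σ₀≡0 : ∀ p {L} (σ : Permutation′ (suc L)) → 2 * p ≡ suc L →
                          ∀ i → coeff (chainPoly p σ) i ≢ 0 → toℕ (σ ⟨$⟩ʳ zero) ≡ 0
chainPoly-support⇒σ₀≡0 p σ 2p≡N i nz = n≤0⇒n≡0 (subst (toℕ (σ ⟨$⟩ʳ zero) ≤_)
  (chainPoly-support≡0 p σ 2p≡N i nz)
  (opChain-head≤support p _ (exponentsTail σ) i nz))

mainTheorem2 : (p : ℕ) → 1 ≤ p → (σ : Permutation′ (2 * p)) →
               ¬ IsZeroPoly (chainPoly p σ) →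
               (i : Fin (2 * p)) → toℕ i ≡ 0 → toℕ (σ ⟨$⟩ʳ i) ≡ 0
mainTheorem2 (suc q) _ σ nonzero zero _ =
  decidable-stable (toℕ (σ ⟨$⟩ʳ zero) ≟ 0) λ σ₀≢0 →
    nonzero (IsZeroPoly-unless (chainPoly (suc q) σ)
              (chainPoly-support⇒σ₀≡0 (suc q) σ refl) σ₀≢0)
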